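{- Let $A$ be the adjacency matrix of a Paley type strongly regular graph with parameters $(v,k,\lambda,\lambda+1)$. Fix a row of $A$ and let $R$ denote its support. Let $\mathcal{B}=\{R\cap S\mid S\ (\neq R)\text{ is the support of a row of }A\}$, and let $\mathcal{B}_\infty$ be the collection consisting of all members of $\mathcal{B}$ of size $\lambda+1$, together with all members of $\mathcal{B}$ of size $\lambda$ each modified by adjoining a new point $\infty$. Then $(R\cup\{\infty\},\mathcal{B}_\infty)$ is a $2$-$(k+1,\lambda+1,\lambda-1)$ adesign.
   Context: A strongly regular graph with parameters $(v,k,\lambda,\mu)$ is a graph on $v$ vertices, regular of degree $k$, in which any two adjacent vertices have exactly $\lambda$ common neighbours and any two distinct non-adjacent vertices have exactly $\mu$ common neighbours. It is of Paley type if, up to complementation, its parameters are $(v,\frac{v-1}{2},\frac{v-5}{4},\frac{v-1}{4})$. A $2$-$(v,k,\lambda)$ adesign is an incidence structure with $v$ points and all blocks of size $k$, in which every pair of distinct points lies in either $\lambda$ or $\lambda+1$ blocks for a positive integer $\lambda$, and which is not a $2$-design (i.e., not every pair lies in the same number of blocks). -}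

module Defs where

open import Data.Nat using (ℕ; zero; suc; _+_; _*_; _<_)
import Data.Nat as ℕ
open import Data.Bool using (Bool; true; false; _∧_; if_then_else_)
import Data.Bool as B
open import Data.Fin using (Fin)
open import Data.Fin.Subset using (Subset; ∣_∣; _∩_; _∈_; _⊆_)
open import Data.Vec using (Vec; tabulate; lookup; _∷_)
open import Data.Vec.Properties using (≡-dec)
open import Data.List using (List; []; _∷_; [_]; concatMap; allFin)
open import Data.List.Relation.Unary.All using (All)
open import Data.Product using (_×_)
open import Data.Sum using (_⊎_)
open import Relation.Binary.PropositionalEquality using (_≡_; _≢_)
open import Relation.Nullary using (¬_; yes; no)

Adj : ℕ → Set
Adj v = Fin v → Fin v → Bool

IsSimpleAdj : ∀ {v} → Adj v → Set
IsSimpleAdj {v} A = (∀ (x y : Fin v) → A x y ≡ A y x) × (∀ (x : Fin v) → A x x ≡ false)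

row : ∀ {v} → Adj v → Fin v → Subset v
row A x = tabulate (A x)

IsSRG : (v k lam mu : ℕ) → Adj v → Set
IsSRG v k lam mu A =
  IsSimpleAdj A ×
  (∀ (x : Fin v) → ∣ row A x ∣ ≡ k) ×
  (∀ (x y : Fin v) → x ≢ y → A x y ≡ true → ∣ row A x ∩ row A y ∣ ≡ lam) ×
  (∀ (x y : Fin v) → x ≢ y → A x y ≡ false → ∣ row A x ∩ row A y ∣ ≡ mu)

-- Paley-type parameters: (v,k,lam,mu) = (v,(v-1)/2,(v-5)/4,(v-1)/4),
-- stated without division.  (This parameter set is closed under
-- complementation, so "up to complementation" adds nothing.)
IsPaleyTypeParams : (v k lam mu : ℕ) → Set
IsPaleyTypeParams v k lam mu =
  (2 * k + 1 ≡ v) × (4 * lam + 5 ≡ v) × (4 * mu + 1 ≡ v)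

pairCount : ∀ {n} → List (Subset n) → Fin n → Fin n → ℕ
pairCount [] p q = 0
pairCount (B ∷ Bs) p q =
  if lookup B p ∧ lookup B q then suc (pairCount Bs p q) else pairCount Bs p q

IsAdesign : ∀ {n} → Subset n → List (Subset n) → (v k lam : ℕ) → Set
IsAdesign {n} P Bs v k lam =
  ∣ P ∣ ≡ v ×
  All (λ B → B ⊆ P × ∣ B ∣ ≡ k) Bs ×
  0 < lam ×
  (∀ (p q : Fin n) → p ∈ P → q ∈ P → p ≢ q →
     (pairCount Bs p q ≡ lam) ⊎ (pairCount Bs p q ≡ suc lam)) ×
  ¬ (∀ (p q p' q' : Fin n) → p ∈ P → q ∈ P → p ≢ q → p' ∈ P → q' ∈ P → p' ≢ q' →
       pairCount Bs p q ≡ pairCount Bs p' q')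

-- The construction.  Ambient point type Fin (suc v): zero is the new
-- point ∞, and suc x is vertex x.
-- Point set R ∪ {∞}, where R = support of row x0.
infPoints : ∀ {v} → Adj v → Fin v → Subset (suc v)
infPoints A x0 = true ∷ row A x0

blockFrom : ∀ {v} → Adj v → (lam : ℕ) → Fin v → Fin v → List (Subset (suc v))
blockFrom A lam x0 y with ≡-dec B._≟_ (row A y) (row A x0)
... | yes _ = []
... | no _ with ∣ row A x0 ∩ row A y ∣ ℕ.≟ suc lam | ∣ row A x0 ∩ row A y ∣ ℕ.≟ lam
... | yes _ | _ = [ false ∷ (row A x0 ∩ row A y) ]
... | no _ | yes _ = [ true ∷ (row A x0 ∩ row A y) ]
... | no _ | no _ = []

infBlocks : ∀ {v} → Adj v → (lam : ℕ) → Fin v → List (Subset (suc v))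
infBlocks {v} A lam x0 = concatMap (blockFrom A lam x0) (allFin v)

-- For a ∈ R the blocks through ∞ and a come from the rows y ∈ R ∩ N(a), so there are
-- exactly λ of them.  For distinct a, b ∈ R the blocks through a and b come from the
-- common neighbours y ≠ x0 of a and b; x0 itself is one of their common neighbours, so
-- there are λ − 1 or λ of them according as a ~ b or not.  Since R contains an edge,
-- both values occur.  The Paley parameters are only needed to see that no other row has
-- support R, which follows from k > λ + 1.
module Submission where

open import Defs
open import Data.Nat using (ℕ; suc; _∸_; _≤_; _<_; _+_; _*_; z<s)
import Data.Nat as ℕ
open import Data.Nat.Properties
  using (+-cancelʳ-≡; *-cancelˡ-≡; m<m+n; <⇒≢; <⇒≱; ≤-refl; n≤1+n; 1+n≢n; <-trans; m<n⇒0<n∸m; m+[n∸m]≡n; suc-injective)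
open import Data.Nat.Tactic.RingSolver using (solve-∀)
open import Data.Fin using (Fin; zero; suc; _≟_)
import Data.Fin.Properties as Fin
open import Data.Bool using (true; false; _∧_; if_then_else_)
import Data.Bool as B
open import Data.Bool.Properties using (∧-comm)
open import Data.Vec using ([]; _∷_; lookup; here; there)
open import Data.Vec.Properties using (≡-dec; lookup∘tabulate; lookup-zipWith; []=⇒lookup; lookup⇒[]=)
open import Data.List using (List; []; _∷_; [_]; _++_; concat; tabulate)
open import Data.List.Properties using (map-tabulate)
open import Data.List.Relation.Unary.All using (All; [])
open import Data.List.Relation.Unary.All.Properties using (concat⁺; map⁺; tabulate⁺)
open import Data.Fin.Subset using (Subset; inside; outside; ∣_∣; _∩_; _-_; _∈_; _⊆_; Nonempty)
open import Data.Fin.Subset.Properties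
  using (p∩q⊆p; ∩-idem; p─⊥≡p; x∈p∩q⁺; x∈p∩q⁻; nonempty?; Empty-unique; ∣⊥∣≡0)
open import Data.Product using (_×_; _,_; proj₁; proj₂)
open import Data.Sum using (_⊎_; inj₁; inj₂)
open import Relation.Binary.PropositionalEquality
  using (_≡_; _≢_; refl; sym; trans; cong; subst)
open import Relation.Nullary using (¬_; yes; no)
open import Data.Empty using (⊥-elim)

0<∣p∣⇒nonempty : ∀ {n} (p : Subset n) → 0 < ∣ p ∣ → Nonempty p
0<∣p∣⇒nonempty {n} p 0<∣p∣ with nonempty? p
... | yes p≢∅ = p≢∅
... | no p≡∅ = ⊥-elim (<⇒≢ 0<∣p∣ (sym (trans (cong ∣_∣ (Empty-unique p≡∅)) (∣⊥∣≡0 n))))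

lookup[p-x]x≡outside : ∀ {n} (p : Subset n) x → lookup (p - x) x ≡ outside
lookup[p-x]x≡outside (s ∷ p) zero = refl
lookup[p-x]x≡outside (s ∷ p) (suc x) = lookup[p-x]x≡outside p x

y≢x⇒lookup[p-x]y≡lookup[p]y : ∀ {n} (p : Subset n) {x y} → y ≢ x → lookup (p - x) y ≡ lookup p y
y≢x⇒lookup[p-x]y≡lookup[p]y (s ∷ p) {zero} {zero} y≢x = ⊥-elim (y≢x refl)
y≢x⇒lookup[p-x]y≡lookup[p]y (s ∷ p) {zero} {suc y} _ = cong (λ r → lookup r y) (p─⊥≡p p)
y≢x⇒lookup[p-x]y≡lookup[p]y (s ∷ p) {suc x} {zero} _ = refl
y≢x⇒lookup[p-x]y≡lookup[p]y (s ∷ p) {suc x} {suc y} y≢x = y≢x⇒lookup[p-x]y≡lookup[p]y p (λ y≡x → y≢x (cong suc y≡x))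

x∈p⇒∣p∣≡1+∣p-x∣ : ∀ {n} {p : Subset n} {x} → x ∈ p → ∣ p ∣ ≡ suc ∣ p - x ∣
x∈p⇒∣p∣≡1+∣p-x∣ {p = inside ∷ p} here = cong (λ r → suc ∣ r ∣) (sym (p─⊥≡p p))
x∈p⇒∣p∣≡1+∣p-x∣ {p = inside ∷ p} (there x∈p) = cong suc (x∈p⇒∣p∣≡1+∣p-x∣ x∈p)
x∈p⇒∣p∣≡1+∣p-x∣ {p = outside ∷ p} (there x∈p) = x∈p⇒∣p∣≡1+∣p-x∣ x∈p

pairCount-++ : ∀ {m} (Bs Cs : List (Subset m)) p q →
  pairCount (Bs ++ Cs) p q ≡ pairCount Bs p q + pairCount Cs p q
pairCount-++ [] Cs p q = refl
pairCount-++ (B ∷ Bs) Cs p q with lookup B p ∧ lookup B q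
... | true = cong suc (pairCount-++ Bs Cs p q)
... | false = pairCount-++ Bs Cs p q

pairCount-sym : ∀ {m} (Bs : List (Subset m)) p q → pairCount Bs p q ≡ pairCount Bs q p
pairCount-sym [] p q = refl
pairCount-sym (B ∷ Bs) p q rewrite ∧-comm (lookup B p) (lookup B q) with lookup B q ∧ lookup B p
... | true = cong suc (pairCount-sym Bs p q)
... | false = pairCount-sym Bs p q

pairCount-concat-tabulate : ∀ {n m} (blocks : Fin n → List (Subset m)) (S : Subset n) p q →
  (∀ y → pairCount (blocks y) p q ≡ (if lookup S y then 1 else 0)) →
  pairCount (concat (tabulate blocks)) p q ≡ ∣ S ∣
pairCount-concat-tabulate blocks [] p q _ = refl
pairCount-concat-tabulate blocks (s ∷ S) p q indicator
  rewrite pairCount-++ (blocks zero) (concat (tabulate (λ y → blocks (suc y)))) p q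
        | indicator zero
        | pairCount-concat-tabulate (λ y → blocks (suc y)) S p q (λ y → indicator (suc y))
  with s
... | true = refl
... | false = refl

module _ {v} (A : Adj v) where

  lookup-row : ∀ x y → lookup (row A x) y ≡ A x y
  lookup-row x = lookup∘tabulate (A x)

  lookup-row∩row : ∀ x z y → lookup (row A x ∩ row A z) y ≡ A x y ∧ A z y
  lookup-row∩row x z y
    rewrite lookup-zipWith _∧_ y (row A x) (row A z) | lookup-row x y | lookup-row z y = refl

  ∈row⇒adjacent : ∀ {x y} → y ∈ row A x → A x y ≡ true
  ∈row⇒adjacent {x} {y} y∈row = trans (sym (lookup-row x y)) ([]=⇒lookup y∈row)

  adjacent⇒∈row : ∀ {x y} → A x y ≡ true → y ∈ row A x
  adjacent⇒∈row {x} {y} x~y = lookup⇒[]= y (row A x) (trans (lookup-row x y) x~y)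

  ∈row⇒≢ : (∀ x → A x x ≡ false) → ∀ {x y} → y ∈ row A x → x ≢ y
  ∈row⇒≢ irreflexive {x} y∈row refl with trans (sym (∈row⇒adjacent y∈row)) (irreflexive x)
  ... | ()

module Construction {v k lam : ℕ} (A : Adj v) (srg : IsSRG v k lam (suc lam) A)
                    (1+λ<k : suc lam < k) (x0 : Fin v) where

  symmetric : ∀ x y → A x y ≡ A y x
  symmetric = proj₁ (proj₁ srg)

  irreflexive : ∀ x → A x x ≡ false
  irreflexive = proj₂ (proj₁ srg)

  regular : ∀ x → ∣ row A x ∣ ≡ k
  regular = proj₁ (proj₂ srg)

  adjacent : ∀ x y → x ≢ y → A x y ≡ true → ∣ row A x ∩ row A y ∣ ≡ lam
  adjacent = proj₁ (proj₂ (proj₂ srg))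

  nonadjacent : ∀ x y → x ≢ y → A x y ≡ false → ∣ row A x ∩ row A y ∣ ≡ suc lam
  nonadjacent = proj₂ (proj₂ (proj₂ srg))

  R : Subset v
  R = row A x0

  Bs : List (Subset (suc v))
  Bs = infBlocks A lam x0

  ∣R∩row∣ : ∀ {y} → y ≢ x0 → ∣ R ∩ row A y ∣ ≡ (if A x0 y then lam else suc lam)
  ∣R∩row∣ {y} y≢x0 with A x0 y in x0?y
  ... | true = adjacent x0 y (λ x0≡y → y≢x0 (sym x0≡y)) x0?y
  ... | false = nonadjacent x0 y (λ x0≡y → y≢x0 (sym x0≡y)) x0?y

  ∣R∩row∣≤1+λ : ∀ {y} → y ≢ x0 → ∣ R ∩ row A y ∣ ≤ suc lam
  ∣R∩row∣≤1+λ {y} y≢x0 with A x0 y | ∣R∩row∣ y≢x0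
  ... | true | s≡λ = subst (_≤ suc lam) (sym s≡λ) (n≤1+n lam)
  ... | false | s≡1+λ = subst (_≤ suc lam) (sym s≡1+λ) ≤-refl

  row≢R : ∀ {y} → y ≢ x0 → row A y ≢ R
  row≢R {y} y≢x0 row≡R = <⇒≱ 1+λ<k (subst (_≤ suc lam) ∣R∩R∣≡k (∣R∩row∣≤1+λ y≢x0))
    where
    ∣R∩R∣≡k : ∣ R ∩ row A y ∣ ≡ k
    ∣R∩R∣≡k = trans (cong (λ S → ∣ R ∩ S ∣) row≡R) (trans (cong ∣_∣ (∩-idem R)) (regular x0))

  blockFrom-x0 : blockFrom A lam x0 x0 ≡ []
  blockFrom-x0 with ≡-dec B._≟_ R R
  ... | yes _ = refl
  ... | no R≢R = ⊥-elim (R≢R refl)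

  blockFrom-≢ : ∀ {y} → y ≢ x0 → blockFrom A lam x0 y ≡ [ A x0 y ∷ (R ∩ row A y) ]
  blockFrom-≢ {y} y≢x0 with ≡-dec B._≟_ (row A y) R
  ... | yes row≡R = ⊥-elim (row≢R y≢x0 row≡R)
  ... | no _ with ∣ R ∩ row A y ∣ ℕ.≟ suc lam | ∣ R ∩ row A y ∣ ℕ.≟ lam | A x0 y | ∣R∩row∣ y≢x0
  ... | yes _ | _ | false | _ = refl
  ... | yes s≡1+λ | _ | true | s≡λ = ⊥-elim (1+n≢n (trans (sym s≡1+λ) s≡λ))
  ... | no _ | yes _ | true | _ = refl
  ... | no s≢1+λ | _ | false | s≡1+λ = ⊥-elim (s≢1+λ s≡1+λ)
  ... | no _ | no s≢λ | true | s≡λ = ⊥-elim (s≢λ s≡λ)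

  blockFrom-valid : ∀ y → All (λ B → B ⊆ infPoints A x0 × ∣ B ∣ ≡ suc lam) (blockFrom A lam x0 y)
  blockFrom-valid y with y ≟ x0
  ... | yes refl rewrite blockFrom-x0 = []
  ... | no y≢x0 rewrite blockFrom-≢ y≢x0 = (⊆-cons (A x0 y) , ∣block∣) All.∷ []
    where
    ⊆-cons : ∀ s → (s ∷ (R ∩ row A y)) ⊆ infPoints A x0
    ⊆-cons _ here = here
    ⊆-cons _ (there x∈R∩row) = there (p∩q⊆p R (row A y) x∈R∩row)
    ∣block∣ : ∣ A x0 y ∷ (R ∩ row A y) ∣ ≡ suc lam
    ∣block∣ with A x0 y | ∣R∩row∣ y≢x0
    ... | true | s≡λ = cong suc s≡λ
    ... | false | s≡1+λ = s≡1+λ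

  infBlocks-valid : All (λ B → B ⊆ infPoints A x0 × ∣ B ∣ ≡ suc lam) Bs
  infBlocks-valid = concat⁺ (map⁺ (tabulate⁺ blockFrom-valid))

  pairCount-infBlocks : ∀ p q (S : Subset v) → lookup S x0 ≡ false →
    (∀ y → y ≢ x0 → lookup (A x0 y ∷ (R ∩ row A y)) p ∧ lookup (A x0 y ∷ (R ∩ row A y)) q ≡ lookup S y) →
    pairCount Bs p q ≡ ∣ S ∣
  pairCount-infBlocks p q S x0∉S through =
    trans (cong (λ Ls → pairCount (concat Ls) p q) (map-tabulate (λ y → y) (blockFrom A lam x0)))
          (pairCount-concat-tabulate (blockFrom A lam x0) S p q indicator)
    where
    indicator : ∀ y → pairCount (blockFrom A lam x0 y) p q ≡ (if lookup S y then 1 else 0)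
    indicator y with y ≟ x0
    ... | yes refl rewrite blockFrom-x0 | x0∉S = refl
    ... | no y≢x0 rewrite blockFrom-≢ y≢x0 | through y y≢x0 = refl

  pairCount-∞ : ∀ {b} → b ∈ R → pairCount Bs zero (suc b) ≡ lam
  pairCount-∞ {b} b∈R =
    trans (pairCount-infBlocks zero (suc b) (R ∩ row A b) x0∉R∩row through)
          (adjacent x0 b (∈row⇒≢ A irreflexive b∈R) x0~b)
    where
    x0~b = ∈row⇒adjacent A b∈R
    x0∉R∩row : lookup (R ∩ row A b) x0 ≡ false
    x0∉R∩row rewrite lookup-row∩row A x0 b x0 | irreflexive x0 = refl
    through : ∀ y → y ≢ x0 → A x0 y ∧ lookup (R ∩ row A y) b ≡ lookup (R ∩ row A b) y
    through y _ rewrite lookup-row∩row A x0 y b | lookup-row∩row A x0 b y | x0~b | symmetric y b = refl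

  -- x0 is a common neighbour of a and b that contributes no block.
  pairCount-R : ∀ {a b} → a ∈ R → b ∈ R → suc (pairCount Bs (suc a) (suc b)) ≡ ∣ row A a ∩ row A b ∣
  pairCount-R {a} {b} a∈R b∈R =
    trans (cong suc (pairCount-infBlocks (suc a) (suc b) ((row A a ∩ row A b) - x0)
                       (lookup[p-x]x≡outside (row A a ∩ row A b) x0) through))
          (sym (x∈p⇒∣p∣≡1+∣p-x∣ (x∈p∩q⁺ (x0∈row a∈R , x0∈row b∈R))))
    where
    x0~a = ∈row⇒adjacent A a∈R
    x0~b = ∈row⇒adjacent A b∈R
    x0∈row : ∀ {c} → c ∈ R → x0 ∈ row A c
    x0∈row {c} c∈R = adjacent⇒∈row A (trans (symmetric c x0) (∈row⇒adjacent A c∈R))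
    through : ∀ y → y ≢ x0 →
      lookup (R ∩ row A y) a ∧ lookup (R ∩ row A y) b ≡ lookup ((row A a ∩ row A b) - x0) y
    through y y≢x0
      rewrite y≢x⇒lookup[p-x]y≡lookup[p]y (row A a ∩ row A b) y≢x0
            | lookup-row∩row A x0 y a | lookup-row∩row A x0 y b | lookup-row∩row A a b y
            | x0~a | x0~b | symmetric y a | symmetric y b = refl

  module _ (1≤λ : 1 ≤ lam) where

    1+[λ∸1]≡λ : suc (lam ∸ 1) ≡ lam
    1+[λ∸1]≡λ = m+[n∸m]≡n 1≤λ

    pairCount-λ-1-or-λ : ∀ p q → p ∈ infPoints A x0 → q ∈ infPoints A x0 → p ≢ q →
      (pairCount Bs p q ≡ lam ∸ 1) ⊎ (pairCount Bs p q ≡ suc (lam ∸ 1))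
    pairCount-λ-1-or-λ zero zero _ _ p≢q = ⊥-elim (p≢q refl)
    pairCount-λ-1-or-λ zero (suc b) _ (there b∈R) _ =
      inj₂ (trans (pairCount-∞ b∈R) (sym 1+[λ∸1]≡λ))
    pairCount-λ-1-or-λ (suc a) zero (there a∈R) _ _ =
      inj₂ (trans (pairCount-sym Bs (suc a) zero) (trans (pairCount-∞ a∈R) (sym 1+[λ∸1]≡λ)))
    pairCount-λ-1-or-λ (suc a) (suc b) (there a∈R) (there b∈R) p≢q with A a b in a?b
    ... | true = inj₁ (suc-injective (trans (pairCount-R a∈R b∈R)
                                      (trans (adjacent a b a≢b a?b) (sym 1+[λ∸1]≡λ))))
      where a≢b = λ a≡b → p≢q (cong suc a≡b)
    ... | false = inj₂ (suc-injective (trans (pairCount-R a∈R b∈R)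
                                      (trans (nonadjacent a b a≢b a?b) (cong suc (sym 1+[λ∸1]≡λ)))))
      where a≢b = λ a≡b → p≢q (cong suc a≡b)

    -- An edge b ~ c inside R separates the pair (∞, b) from the pair (b, c).
    pairCount-not-constant : ¬ (∀ (p q p' q' : Fin (suc v)) →
      p ∈ infPoints A x0 → q ∈ infPoints A x0 → p ≢ q →
      p' ∈ infPoints A x0 → q' ∈ infPoints A x0 → p' ≢ q' →
      pairCount Bs p q ≡ pairCount Bs p' q')
    pairCount-not-constant constant
      with 0<∣p∣⇒nonempty R (subst (0 <_) (sym (regular x0)) (<-trans z<s 1+λ<k))
    ... | b , b∈R
      with 0<∣p∣⇒nonempty (R ∩ row A b)
             (subst (0 <_) (sym (adjacent x0 b (∈row⇒≢ A irreflexive b∈R) (∈row⇒adjacent A b∈R))) 1≤λ)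
    ... | c , c∈R∩N[b] = 1+n≢n (trans (pairCount-R b∈R c∈R) (trans ∣N[b]∩N[c]∣≡λ (sym bc≡λ)))
      where
      c∈R = proj₁ (x∈p∩q⁻ R (row A b) c∈R∩N[b])
      c∈N[b] = proj₂ (x∈p∩q⁻ R (row A b) c∈R∩N[b])
      b≢c = ∈row⇒≢ A irreflexive c∈N[b]
      ∣N[b]∩N[c]∣≡λ = adjacent b c b≢c (∈row⇒adjacent A c∈N[b])
      bc≡λ : pairCount Bs (suc b) (suc c) ≡ lam
      bc≡λ = trans (sym (constant zero (suc b) (suc b) (suc c) here (there b∈R) (λ ())
                                  (there b∈R) (there c∈R) (λ b≡c → b≢c (Fin.suc-injective b≡c))))
                   (pairCount-∞ b∈R)

paley⇒1+λ<k : ∀ {v k lam} → IsPaleyTypeParams v k lam (suc lam) → suc lam < k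
paley⇒1+λ<k {v} {k} {lam} (2k+1≡v , 4λ+5≡v , _) = subst (suc lam <_) (sym k≡2[1+λ]) (m<m+n (suc lam) z<s)
  where
  4λ+5≡2[2[1+λ]]+1 : ∀ l → 4 * l + 5 ≡ 2 * (suc l + suc l) + 1
  4λ+5≡2[2[1+λ]]+1 = solve-∀
  k≡2[1+λ] : k ≡ suc lam + suc lam
  k≡2[1+λ] = *-cancelˡ-≡ k (suc lam + suc lam) 2
              (+-cancelʳ-≡ 1 (2 * k) (2 * (suc lam + suc lam))
                (trans 2k+1≡v (trans (sym 4λ+5≡v) (4λ+5≡2[2[1+λ]]+1 lam))))

theorem4 : ∀ {v k lam : ℕ} (A : Adj v) →
    IsSRG v k lam (suc lam) A →
    IsPaleyTypeParams v k lam (suc lam) →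
    2 ≤ lam →
    (x0 : Fin v) →
    IsAdesign (infPoints A x0) (infBlocks A lam x0) (suc k) (suc lam) (lam ∸ 1)
theorem4 A srg paley 2≤λ x0 =
    cong suc (regular x0)
  , infBlocks-valid
  , m<n⇒0<n∸m 2≤λ
  , pairCount-λ-1-or-λ 1≤λ
  , pairCount-not-constant 1≤λ
  where
  open Construction A srg (paley⇒1+λ<k paley) x0
  1≤λ = <-trans z<s 2≤λ
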